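{- Let $k\ge1$, $p_1,\dots,p_k\ge 1$, $s_i\ge 0$, $a_{ij}\ge 1$ be integers, and let $r\ge 1$. Suppose $A(n)$ and $B(n)$ are well-defined sequences both satisfying, for all $n>r$, $$A(n)=\sum_{i=1}^k A\Big(n-s_i-\sum_{j=1}^{p_i}A(n-a_{ij})\Big),\qquad B(n)=\sum_{i=1}^k B\Big(n-s_i-\sum_{j=1}^{p_i}B(n-a_{ij})\Big),$$ with initial conditions $A(1),\dots,A(r)$ and $B(1),\dots,B(r)$ respectively. Define $C$ by $C(1),\dots,C(2r)=2A(1),2B(1),2A(2),2B(2),\dots,2A(r),2B(r)$ and, for $n>r$, $C(2n-1)=2A(n)$ and $C(2n)=2B(n)$. Then $C$ is a solution of the "doubled" recursion $$C(n)=\sum_{i=1}^k C\Big(n-2s_i-\sum_{j=1}^{p_i}C(n-2a_{ij})\Big)\qquad (n>2r)$$ with initial conditions $C(1),\dots,C(2r)$. -}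

module Defs where

open import Data.Nat using (ℕ; zero; suc; _∸_) renaming (_<_ to _<ℕ_)
open import Data.Integer using (ℤ; +_; _+_; _-_; _≤_; _<_; ∣_∣)
open import Data.Fin using (Fin) renaming (zero to fzero; suc to fsuc)
open import Data.Product using (_×_)
open import Relation.Binary.PropositionalEquality using (_≡_)

∑ : (n : ℕ) → (Fin n → ℤ) → ℤ
∑ zero    f = + 0
∑ (suc n) f = f fzero + ∑ n (λ i → f (fsuc i))

Arg : (k : ℕ) (p : Fin k → ℕ) (s : Fin k → ℕ) (a : (i : Fin k) → Fin (p i) → ℕ)
      (X : ℕ → ℤ) (n : ℕ) (i : Fin k) → ℤ
Arg k p s a X n i = + n - + s i - ∑ (p i) (λ j → X (n ∸ a i j))

-- Well-definedness of the recursion at position n: every index that is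
-- evaluated lies in {1, …, n-1}.
WellDefinedAt : (k : ℕ) (p : Fin k → ℕ) (s : Fin k → ℕ) (a : (i : Fin k) → Fin (p i) → ℕ)
                (X : ℕ → ℤ) (n : ℕ) → Set
WellDefinedAt k p s a X n =
  (i : Fin k) →
    ((j : Fin (p i)) → a i j <ℕ n)
    × (+ 1 ≤ Arg k p s a X n i)
    × (Arg k p s a X n i < + n)

Solves : (k : ℕ) (p : Fin k → ℕ) (s : Fin k → ℕ) (a : (i : Fin k) → Fin (p i) → ℕ)
         (X : ℕ → ℤ) (r : ℕ) → Set
Solves k p s a X r =
  (n : ℕ) → r <ℕ n →
    WellDefinedAt k p s a X n
    × (X n ≡ ∑ k (λ i → X ∣ Arg k p s a X n i ∣))

module Submission where

-- Let X solve the recursion with shifts s_i and offsets a_ij, and let C be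
-- a function with C(2m - e) = 2 X(m) for all m ≥ 1, where e ∈ {0, 1} is a
-- fixed offset.  Then at every position 2m - e the argument of the i-th
-- outer term of the doubled recursion (shifts 2 s_i, offsets 2 a_ij) is
-- exactly twice the argument of the original recursion at m, minus e:
--   (2m - e) - 2 s_i - Σ_j C(2m - e - 2 a_ij) = 2 (m - s_i - Σ_j X(m - a_ij)) - e.
-- Hence every index evaluated by the doubled recursion is again of the form
-- 2t - e with 1 ≤ t < m, its value is 2 X(t), and the recursion for X at m,
-- multiplied by 2, is the doubled recursion for C at 2m - e.
--
-- The theorem follows
-- by writing n > 2r as 2m (use B, e = 0) or 2m - 1 (use A, e = 1) with m > r.

open import Defs
open import Data.Nat using (ℕ; zero; suc; _*_; _≤_; _∸_; z≤n; s≤s)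
  renaming (_<_ to _<ℕ_; _+_ to _+ℕ_)
import Data.Nat.Properties as ℕP
open import Data.Integer using (ℤ; +_; _+_; _-_; ∣_∣; +≤+; +<+)
  renaming (_*_ to _*ℤ_; _≤_ to _≤ℤ_; _<_ to _<ℤ_)
import Data.Integer.Properties as ℤP
open import Data.Integer.Solver using (module +-*-Solver)
open import Data.Fin using (Fin) renaming (zero to fzero; suc to fsuc)
open import Data.Product using (∃; _,_; _×_; proj₁; proj₂)
open import Data.Sum using (_⊎_; inj₁; inj₂)
open import Relation.Binary.PropositionalEquality
  using (_≡_; refl; sym; trans; cong; cong₂; subst; module ≡-Reasoning)

∑-cong : ∀ n {f g : Fin n → ℤ} → (∀ j → f j ≡ g j) → ∑ n f ≡ ∑ n g
∑-cong zero    eq = refl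
∑-cong (suc n) eq = cong₂ _+_ (eq fzero) (∑-cong n (λ j → eq (fsuc j)))

∑-scale : ∀ n (c : ℤ) (g : Fin n → ℤ) → ∑ n (λ j → c *ℤ g j) ≡ c *ℤ ∑ n g
∑-scale zero    c g = sym (ℤP.*-zeroʳ c)
∑-scale (suc n) c g = begin
  c *ℤ g fzero + ∑ n (λ j → c *ℤ g (fsuc j)) ≡⟨ cong (λ x → c *ℤ g fzero + x) (∑-scale n c (λ j → g (fsuc j))) ⟩
  c *ℤ g fzero + c *ℤ ∑ n (λ j → g (fsuc j))  ≡⟨ ℤP.*-distribˡ-+ c (g fzero) _ ⟨
  c *ℤ ∑ (suc n) g                             ∎
  where open ≡-Reasoning

pos-∸ : ∀ m n → n ≤ m → + (m ∸ n) ≡ + m - + n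
pos-∸ m n n≤m = sym (trans (ℤP.m-n≡m⊖n m n) (ℤP.⊖-≥ n≤m))

parity : ∀ n → ∃ λ m → (n ≡ 2 * m) ⊎ (suc n ≡ 2 * m)
parity zero = 0 , inj₁ refl
parity (suc n) with parity n
... | m , inj₁ n≡2m    = suc m , inj₂ (trans (cong (λ x → suc (suc x)) n≡2m) (sym (ℕP.*-suc 2 m)))
... | m , inj₂ 1+n≡2m = m , inj₁ 1+n≡2m

-- Parity in the form used for C: n = 2m - e with e ∈ {0, 1}
-- (the even case is written 2m ∸ 0, which is definitionally 2m).
halve : ∀ n → ∃ λ m → (n ≡ 2 * m ∸ 0) ⊎ (n ≡ 2 * m ∸ 1)
halve n with parity n
... | m , inj₁ n≡2m    = m , inj₁ n≡2m
... | m , inj₂ 1+n≡2m = m , inj₂ (cong (_∸ 1) 1+n≡2m)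

scaled-index : ∀ c m e a → c * m ∸ e ∸ c * a ≡ c * (m ∸ a) ∸ e
scaled-index c m e a = begin
  c * m ∸ e ∸ c * a    ≡⟨ ℕP.∸-+-assoc (c * m) e (c * a) ⟩
  c * m ∸ (e +ℕ c * a) ≡⟨ cong (c * m ∸_) (ℕP.+-comm e (c * a)) ⟩
  c * m ∸ (c * a +ℕ e) ≡⟨ ℕP.∸-+-assoc (c * m) (c * a) e ⟨
  c * m ∸ c * a ∸ e    ≡⟨ cong (_∸ e) (ℕP.*-distribˡ-∸ c m a) ⟨
  c * (m ∸ a) ∸ e      ∎
  where open ≡-Reasoning

halve-bound : ∀ r m e → 2 * r <ℕ 2 * m ∸ e → r <ℕ m
halve-bound r m e 2r<2m-e = ℕP.*-cancelˡ-< 2 r m (ℕP.<-≤-trans 2r<2m-e (ℕP.m∸n≤m (2 * m) e))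

open +-*-Solver using (solve; _:*_; _:-_; con; _:=_)

doubled-argument-identity : ∀ M E S W →
  + 2 *ℤ M - E - + 2 *ℤ S - + 2 *ℤ W ≡ + 2 *ℤ (M - S - W) - E
doubled-argument-identity = solve 4 (λ M E S W →
  con (+ 2) :* M :- E :- con (+ 2) :* S :- con (+ 2) :* W := con (+ 2) :* (M :- S :- W) :- E) refl

module Doubling
  (k : ℕ) (p : Fin k → ℕ) (s : Fin k → ℕ) (a : (i : Fin k) → Fin (p i) → ℕ)
  (X C : ℕ → ℤ) (e : ℕ) (e≤1 : e ≤ 1)
  (C-doubles : ∀ m → 1 ≤ m → C (2 * m ∸ e) ≡ + 2 *ℤ X m)
  where

  DoubledArg : ℕ → Fin k → ℤ
  DoubledArg m i = Arg k p (λ i → 2 * s i) (λ i j → 2 * a i j) C (2 * m ∸ e) i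

  -- For t ≥ 1 the offset e is strictly below 2t, so 2t - e does not truncate.
  e<2t : ∀ t → 1 ≤ t → e <ℕ 2 * t
  e<2t t 1≤t = ℕP.≤-<-trans e≤1 (ℕP.*-monoʳ-≤ 2 1≤t)

  pos-double-∸ : ∀ t → 1 ≤ t → + (2 * t ∸ e) ≡ + 2 *ℤ + t - + e
  pos-double-∸ t 1≤t = trans (pos-∸ (2 * t) e (ℕP.<⇒≤ (e<2t t 1≤t))) (cong (_- + e) (ℤP.pos-* 2 t))

  doubled-bounds : ∀ t m → 1 ≤ t → t <ℕ m → (1 ≤ 2 * t ∸ e) × (2 * t ∸ e <ℕ 2 * m ∸ e)
  doubled-bounds t m 1≤t t<m =
    ℕP.m<n⇒0<n∸m (e<2t t 1≤t) , ℕP.∸-monoˡ-< (ℕP.*-monoʳ-< 2 t<m) (ℕP.<⇒≤ (e<2t t 1≤t))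

  doubled-offset : ∀ x m → x <ℕ m → 2 * x <ℕ 2 * m ∸ e
  doubled-offset x m x<m = ℕP.≤-trans 1+2x≤2m-1 (ℕP.∸-monoʳ-≤ (2 * m) e≤1)
    where
    1+2x≤2m-1 : suc (2 * x) ≤ 2 * m ∸ 1
    1+2x≤2m-1 = subst (λ y → y ∸ 1 ≤ 2 * m ∸ 1) (ℕP.*-suc 2 x) (ℕP.∸-monoˡ-≤ 1 (ℕP.*-monoʳ-≤ 2 x<m))

  inner-sum-doubles : ∀ m i → (∀ j → a i j <ℕ m) →
    ∑ (p i) (λ j → C (2 * m ∸ e ∸ 2 * a i j)) ≡ + 2 *ℤ ∑ (p i) (λ j → X (m ∸ a i j))
  inner-sum-doubles m i a<m = trans (∑-cong (p i) C-term≡2X) (∑-scale (p i) (+ 2) _)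
    where
    C-term≡2X : ∀ j → C (2 * m ∸ e ∸ 2 * a i j) ≡ + 2 *ℤ X (m ∸ a i j)
    C-term≡2X j = trans (cong C (scaled-index 2 m e (a i j)))
                        (C-doubles (m ∸ a i j) (ℕP.m<n⇒0<n∸m (a<m j)))

  argument-doubles : ∀ m i → 1 ≤ m → (∀ j → a i j <ℕ m) →
    DoubledArg m i ≡ + 2 *ℤ Arg k p s a X m i - + e
  argument-doubles m i 1≤m a<m = begin
    + (2 * m ∸ e) - + (2 * s i) - ∑ (p i) (λ j → C (2 * m ∸ e ∸ 2 * a i j))
      ≡⟨ cong₂ (λ u v → u - v - ∑ (p i) (λ j → C (2 * m ∸ e ∸ 2 * a i j)))
               (pos-double-∸ m 1≤m) (ℤP.pos-* 2 (s i)) ⟩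
    + 2 *ℤ + m - + e - + 2 *ℤ + s i - ∑ (p i) (λ j → C (2 * m ∸ e ∸ 2 * a i j))
      ≡⟨ cong (λ w → + 2 *ℤ + m - + e - + 2 *ℤ + s i - w) (inner-sum-doubles m i a<m) ⟩
    + 2 *ℤ + m - + e - + 2 *ℤ + s i - + 2 *ℤ ∑ (p i) (λ j → X (m ∸ a i j))
      ≡⟨ doubled-argument-identity (+ m) (+ e) (+ s i) _ ⟩
    + 2 *ℤ Arg k p s a X m i - + e
      ∎
    where open ≡-Reasoning

  doubled-position : ∀ m z → + 1 ≤ℤ z → z <ℤ + m →
    (+ 1 ≤ℤ + 2 *ℤ z - + e) × (+ 2 *ℤ z - + e <ℤ + (2 * m ∸ e)) ×
    (C ∣ + 2 *ℤ z - + e ∣ ≡ + 2 *ℤ X ∣ z ∣)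
  doubled-position m (+ t) (+≤+ 1≤t) (+<+ t<m) rewrite sym (pos-double-∸ t 1≤t) =
    +≤+ (proj₁ bounds) , +<+ (proj₂ bounds) , C-doubles t 1≤t
    where
    bounds : (1 ≤ 2 * t ∸ e) × (2 * t ∸ e <ℕ 2 * m ∸ e)
    bounds = doubled-bounds t m 1≤t t<m

  doubled-step : ∀ m → 1 ≤ m →
    WellDefinedAt k p s a X m × (X m ≡ ∑ k (λ i → X ∣ Arg k p s a X m i ∣)) →
    WellDefinedAt k p (λ i → 2 * s i) (λ i j → 2 * a i j) C (2 * m ∸ e) ×
    (C (2 * m ∸ e) ≡ ∑ k (λ i → C ∣ DoubledArg m i ∣))
  doubled-step m 1≤m (wd , X-rec) = wd₂ , C-rec
    where
    arg-eq : ∀ i → DoubledArg m i ≡ + 2 *ℤ Arg k p s a X m i - + e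
    arg-eq i = argument-doubles m i 1≤m (proj₁ (wd i))

    position : ∀ i →
      (+ 1 ≤ℤ + 2 *ℤ Arg k p s a X m i - + e) × (+ 2 *ℤ Arg k p s a X m i - + e <ℤ + (2 * m ∸ e)) ×
      (C ∣ + 2 *ℤ Arg k p s a X m i - + e ∣ ≡ + 2 *ℤ X ∣ Arg k p s a X m i ∣)
    position i = doubled-position m (Arg k p s a X m i) (proj₁ (proj₂ (wd i))) (proj₂ (proj₂ (wd i)))

    wd₂ : WellDefinedAt k p (λ i → 2 * s i) (λ i j → 2 * a i j) C (2 * m ∸ e)
    wd₂ i = (λ j → doubled-offset (a i j) m (proj₁ (wd i) j))
          , subst (+ 1 ≤ℤ_) (sym (arg-eq i)) (proj₁ (position i))
          , subst (_<ℤ + (2 * m ∸ e)) (sym (arg-eq i)) (proj₁ (proj₂ (position i)))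

    C-at-arg : ∀ i → C ∣ DoubledArg m i ∣ ≡ + 2 *ℤ X ∣ Arg k p s a X m i ∣
    C-at-arg i = trans (cong (λ z → C ∣ z ∣) (arg-eq i)) (proj₂ (proj₂ (position i)))

    C-rec : C (2 * m ∸ e) ≡ ∑ k (λ i → C ∣ DoubledArg m i ∣)
    C-rec = begin
      C (2 * m ∸ e)                                 ≡⟨ C-doubles m 1≤m ⟩
      + 2 *ℤ X m                                    ≡⟨ cong (+ 2 *ℤ_) X-rec ⟩
      + 2 *ℤ ∑ k (λ i → X ∣ Arg k p s a X m i ∣)   ≡⟨ ∑-scale k (+ 2) _ ⟨
      ∑ k (λ i → + 2 *ℤ X ∣ Arg k p s a X m i ∣)   ≡⟨ ∑-cong k (λ i → sym (C-at-arg i)) ⟩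
      ∑ k (λ i → C ∣ DoubledArg m i ∣)              ∎
      where open ≡-Reasoning

theorem2p3 : (k : ℕ) → 1 ≤ k →
    (p : Fin k → ℕ) → ((i : Fin k) → 1 ≤ p i) →
    (s : Fin k → ℕ) →
    (a : (i : Fin k) → Fin (p i) → ℕ) → ((i : Fin k) (j : Fin (p i)) → 1 ≤ a i j) →
    (r : ℕ) → 1 ≤ r →
    (A B C : ℕ → ℤ) →
    Solves k p s a A r →
    Solves k p s a B r →
    ((n : ℕ) → 1 ≤ n → C (2 * n ∸ 1) ≡ + 2 *ℤ A n) →
    ((n : ℕ) → 1 ≤ n → C (2 * n) ≡ + 2 *ℤ B n) →
    Solves k p (λ i → 2 * s i) (λ i j → 2 * a i j) C (2 * r)
theorem2p3 k _ p _ s a _ r _ A B C solA solB C-odd C-even n 2r<n with halve n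
... | m , inj₁ refl = Doubling.doubled-step k p s a B C 0 z≤n C-even m 1≤m (solB m r<m)
  where
  r<m : r <ℕ m
  r<m = halve-bound r m 0 2r<n
  1≤m : 1 ≤ m
  1≤m = ℕP.≤-trans (s≤s z≤n) r<m
... | m , inj₂ refl = Doubling.doubled-step k p s a A C 1 ℕP.≤-refl C-odd m 1≤m (solA m r<m)
  where
  r<m : r <ℕ m
  r<m = halve-bound r m 1 2r<n
  1≤m : 1 ≤ m
  1≤m = ℕP.≤-trans (s≤s z≤n) r<m
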